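{- Let $n\ge 3$ and let $R\cong\prod_{i=1}^n F_i$, where each $F_i$ is a finite field. Then $\operatorname{sdim}_M(\Gamma^c(R))=|Z^*(R)|-2^{n-1}+1$.
   Context: $Z^*(R)$ is the set of nonzero zero-divisors of the commutative ring $R$ (nonzero $x$ with $xy=0$ for some $y\neq0$). The zero-divisor graph $\Gamma(R)$ has vertex set $Z^*(R)$, distinct $x,y$ adjacent iff $xy=0$; $\Gamma^c(R)$ is its complement (same vertex set, distinct $x,y$ adjacent iff $xy\neq 0$). In a connected graph $G$, a vertex $w$ strongly resolves $u,v$ if some shortest $u$–$w$ path contains $v$ or some shortest $v$–$w$ path contains $u$; $W\subseteq V(G)$ is a strong resolving set if every pair of distinct vertices is strongly resolved by some vertex in $W$; $\operatorname{sdim}_M(G)$ is the minimum size of a strong resolving set. -}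

module Defs where

open import Data.Nat using (ℕ; zero; suc; _≤_)
open import Data.Fin using (Fin)
open import Data.Vec using (Vec; []; _∷_)
open import Data.List using (List; []; _∷_; length)
open import Data.List.Membership.Propositional using (_∈_)
open import Data.List.Relation.Unary.Unique.Propositional using (Unique)
open import Data.Product using (Σ; ∃; _×_; _,_)
open import Data.Sum using (_⊎_)
open import Data.Unit using (⊤; tt)
open import Relation.Nullary using (¬_)
open import Relation.Binary.PropositionalEquality using (_≡_; _≢_)
open import Algebra.Structures using (IsCommutativeRing)
open import Function.Bundles using (_↔_)
open import Function.Definitions using (Bijective)

record CRing : Set₁ where
  field
    Carrier : Set
    _+_ _*_ : Carrier → Carrier → Carrier
    -_ : Carrier → Carrier
    0# 1# : Carrier
    isCommutativeRing : IsCommutativeRing _≡_ _+_ _*_ -_ 0# 1#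

record FiniteField : Set₁ where
  field
    Carrier : Set
    _+_ _*_ : Carrier → Carrier → Carrier
    -_ : Carrier → Carrier
    0# 1# : Carrier
    isCommutativeRing : IsCommutativeRing _≡_ _+_ _*_ -_ 0# 1#
    1≢0 : 1# ≢ 0#
    inverse : ∀ x → x ≢ 0# → ∃ λ y → x * y ≡ 1#
    size : ℕ
    enum : Fin size ↔ Carrier

Prod : ∀ {n} → Vec FiniteField n → Set
Prod [] = ⊤
Prod (F ∷ Fs) = FiniteField.Carrier F × Prod Fs

_+ᴾ_ : ∀ {n} {Fs : Vec FiniteField n} → Prod Fs → Prod Fs → Prod Fs
_+ᴾ_ {Fs = []} tt tt = tt
_+ᴾ_ {Fs = F ∷ Fs} (a , as) (b , bs) = FiniteField._+_ F a b , (as +ᴾ bs)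

_*ᴾ_ : ∀ {n} {Fs : Vec FiniteField n} → Prod Fs → Prod Fs → Prod Fs
_*ᴾ_ {Fs = []} tt tt = tt
_*ᴾ_ {Fs = F ∷ Fs} (a , as) (b , bs) = FiniteField._*_ F a b , (as *ᴾ bs)

1ᴾ : ∀ {n} (Fs : Vec FiniteField n) → Prod Fs
1ᴾ [] = tt
1ᴾ (F ∷ Fs) = FiniteField.1# F , 1ᴾ Fs

record RingIso (R : CRing) {n} (Fs : Vec FiniteField n) : Set where
  open CRing R
  field
    to : Carrier → Prod Fs
    bijective : Bijective _≡_ _≡_ to
    to-+ : ∀ x y → to (x + y) ≡ (to x +ᴾ to y)
    to-* : ∀ x y → to (x * y) ≡ (to x *ᴾ to y)
    to-1 : to 1# ≡ 1ᴾ Fs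

-- Graph notions: a graph whose vertices are the elements a of A with V a,
-- and whose adjacency relation is E (E only relates vertices).

module Graph {A : Set} (V : A → Set) (E : A → A → Set) where

  data Walk : A → A → Set where
    nil  : ∀ u → Walk u u
    cons : ∀ u {v w} → E u v → Walk v w → Walk u w

  len : ∀ {u w} → Walk u w → ℕ
  len (nil u) = 0
  len (cons u e p) = suc (len p)

  vertices : ∀ {u w} → Walk u w → List A
  vertices (nil u) = u ∷ []
  vertices (cons u e p) = u ∷ vertices p

  IsShortest : ∀ {u w} → Walk u w → Set
  IsShortest {u} {w} p = ∀ (q : Walk u w) → len p ≤ len q

  StronglyResolves : A → A → A → Set
  StronglyResolves w u v =
    (Σ (Walk u w) λ p → IsShortest p × v ∈ vertices p)
    ⊎ (Σ (Walk v w) λ p → IsShortest p × u ∈ vertices p)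

  IsStrongResolvingSet : List A → Set
  IsStrongResolvingSet W =
    (∀ {w} → w ∈ W → V w) ×
    (∀ u v → V u → V v → u ≢ v → Σ A λ w → w ∈ W × StronglyResolves w u v)

  IsStrongMetricDim : ℕ → Set
  IsStrongMetricDim k =
    (Σ (List A) λ W → IsStrongResolvingSet W × Unique W × length W ≡ k) ×
    (∀ W → IsStrongResolvingSet W → Unique W → k ≤ length W)

module _ (R : CRing) where
  open CRing R

  IsZ* : Carrier → Set
  IsZ* x = x ≢ 0# × Σ Carrier λ y → y ≢ 0# × x * y ≡ 0#

  AdjΓᶜ : Carrier → Carrier → Set
  AdjΓᶜ x y = IsZ* x × IsZ* y × x ≢ y × x * y ≢ 0#

  module Γᶜ = Graph IsZ* AdjΓᶜ

  -- Z is a list of the elements of Z*(R) without repetition (so |Z*(R)| = length Z)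
  Enumerates-Z* : List Carrier → Set
  Enumerates-Z* Z = Unique Z × (∀ x → (x ∈ Z → IsZ* x) × (IsZ* x → x ∈ Z))

{-# OPTIONS --safe #-}
-- Write x ∈ R ≅ F₁ × ⋯ × Fₙ through its support, the set of coordinates where x is nonzero.
-- Then x ∈ Z*(R) iff its support S is proper and nonempty, and x, y are adjacent in Γᶜ(R)
-- iff their supports meet.  For n ≥ 3 any two vertices have a common neighbour (the
-- idempotent supported on one coordinate from each), so Γᶜ(R) has diameter at most 2, and
-- a vertex w ∉ {x, y} strongly resolves x, y only along a geodesic x – y – w with x, w
-- non-adjacent.  No such geodesic exists when the supports of x and y are equal or disjoint,
-- so the vertices outside a strong resolving set have pairwise distinct supports modulo
-- S ~ ∁S: there are at most 2ⁿ⁻¹ − 1 of them.  Conversely, leaving out exactly the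
-- idempotents e_S ∈ Z*(R) whose support S contains the first coordinate gives a strong
-- resolving set: if i ∈ T ∖ S, the geodesic e_S – e_T – e_{i} shows that e_{i} resolves
-- e_S and e_T.
module Submission where

open import Defs
open import Algebra.Structures using (IsCommutativeRing)
open import Data.Bool using (not; _∧_; if_then_else_)
open import Data.Bool.Properties using (not-injective)
open import Data.Fin using (Fin; zero; suc)
open import Data.Fin.Properties using (injective⇒≤; inj⇒≟)
open import Data.Fin.Subset using (Subset; Side; inside; outside; ⊥; ⊤; ⁅_⁆; _∩_; _∪_; ∁; Nonempty)
  renaming (_∈_ to _∈ₛ_; _∉_ to _∉ₛ_)
open import Data.Fin.Subset.Properties
  using ( ∉⊥; ∈⊤; x∈⁅x⁆; x∈⁅y⁆⇒x≡y; drop-there; x∈p⇒x∉∁p; x∈p∩q⁺; x∈p∩q⁻; x∈p∪q⁺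
        ; ∩-zeroʳ; ∩-identityˡ; ∩-inverseʳ; nonempty?; Empty-unique)
  renaming (_∈?_ to _∈ₛ?_)
open import Data.List using (List; []; _∷_; length; lookup; filter; map; _++_)
open import Data.List.Properties using (length-++; length-map)
open import Data.List.Membership.Propositional using (_∈_)
open import Data.List.Membership.Propositional.Properties
  using (∈-lookup; ∈-filter⁺; ∈-filter⁻; ∈-map⁺; ∈-map⁻; ∈-++⁺ˡ; ∈-++⁺ʳ; ∈-++⁻)
open import Data.List.Membership.Setoid.Properties using (index-injective)
open import Data.List.Relation.Binary.Disjoint.Propositional using (Disjoint)
open import Data.List.Relation.Unary.All as All using ([])
open import Data.List.Relation.Unary.AllPairs using ([]; _∷_)
open import Data.List.Relation.Unary.Any as Any using (here; there)
open import Data.List.Relation.Unary.Unique.Propositional using (Unique)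
import Data.List.Relation.Unary.Unique.Propositional.Properties as Unique
open import Data.Nat using (ℕ; zero; suc; _≤_; _+_; _∸_; _^_; z≤n; s≤s)
open import Data.Nat.Properties
  using (module ≤-Reasoning; +-commutativeSemigroup; +-comm; +-suc; +-identityʳ; +-cancelˡ-≤; +-mono-≤; ≤⇒≯
        ; ≤-refl; ≤-trans; ≤-antisym)
open import Algebra.Properties.CommutativeSemigroup +-commutativeSemigroup using (xy∙z≈xz∙y; x∙yz≈yx∙z)
open import Data.Product using (Σ; ∃; _×_; _,_; proj₁; proj₂)
open import Data.Product.Properties using (≡-dec)
open import Data.Sum using (_⊎_; inj₁; inj₂)
import Data.Sum as Sum
open import Data.Unit using (tt)
open import Data.Unit.Properties using () renaming (_≟_ to ⊤-≟)
open import Data.Vec using (Vec; []; _∷_; tail; here; there)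
open import Data.Vec.Properties using (∷-injectiveˡ; ∷-injectiveʳ)
open import Function using (_∘_; id)
open import Function.Properties.Inverse using (↔⇒↣; ↔-sym)
open import Relation.Binary using (DecidableEquality)
open import Relation.Binary.PropositionalEquality
  using (_≡_; _≢_; refl; sym; trans; cong; cong₂; subst; setoid; module ≡-Reasoning)
open import Relation.Nullary using (¬_; yes; no; does; contradiction; _×-dec_)
open import Relation.Nullary.Decidable using (dec-true; dec-false; map′)
open import Relation.Unary using (Decidable)
open import Relation.Unary.Properties using (∁?)

Unique⇒lookup-injective : ∀ {A : Set} {xs : List A} → Unique xs →
  ∀ i j → lookup xs i ≡ lookup xs j → i ≡ j
Unique⇒lookup-injective (_ ∷ _) zero zero _ = refl
Unique⇒lookup-injective (x∉xs ∷ _) zero (suc j) eq = contradiction eq (All.lookup x∉xs (∈-lookup j))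
Unique⇒lookup-injective (x∉xs ∷ _) (suc i) zero eq = contradiction (sym eq) (All.lookup x∉xs (∈-lookup i))
Unique⇒lookup-injective (_ ∷ u) (suc i) (suc j) eq = cong suc (Unique⇒lookup-injective u i j eq)

injectiveOn⇒length≤ : ∀ {A B : Set} {xs : List A} {ys : List B} (f : A → B) → Unique xs →
  (∀ {x} → x ∈ xs → f x ∈ ys) →
  (∀ {x y} → x ∈ xs → y ∈ xs → f x ≡ f y → x ≡ y) →
  length xs ≤ length ys
injectiveOn⇒length≤ {B = B} {xs} {ys} f u into inj = injective⇒≤ {f = index} index-inj
  where
  index : Fin (length xs) → Fin (length ys)
  index i = Any.index (into (∈-lookup i))
  index-inj : ∀ {i j} → index i ≡ index j → i ≡ j
  index-inj {i} {j} eq = Unique⇒lookup-injective u i j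
    (inj (∈-lookup i) (∈-lookup j) (index-injective (setoid B) (into (∈-lookup i)) (into (∈-lookup j)) eq))

length-filter-∁ : ∀ {A : Set} {P : A → Set} (P? : Decidable P) (xs : List A) →
  length xs ≡ length (filter P? xs) + length (filter (∁? P?) xs)
length-filter-∁ P? [] = refl
length-filter-∁ P? (x ∷ xs) with P? x
... | yes _ = cong suc (length-filter-∁ P? xs)
... | no _ = trans (cong suc (length-filter-∁ P? xs)) (sym (+-suc _ _))

-- Subsets of coordinates

≢⊤⇒∁-nonempty : ∀ {n} (p : Subset n) → p ≢ ⊤ → Nonempty (∁ p)
≢⊤⇒∁-nonempty [] p≢⊤ = contradiction refl p≢⊤
≢⊤⇒∁-nonempty (outside ∷ p) _ = zero , here
≢⊤⇒∁-nonempty (inside ∷ p) p≢⊤ with ≢⊤⇒∁-nonempty p (p≢⊤ ∘ cong (inside ∷_))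
... | i , i∈∁p = suc i , there i∈∁p

⁅i⁆∪⁅j⁆≢⊤ : ∀ {n} → 3 ≤ n → (i j : Fin n) → ⁅ i ⁆ ∪ ⁅ j ⁆ ≢ ⊤
⁅i⁆∪⁅j⁆≢⊤ (s≤s (s≤s (s≤s _))) zero zero = λ ()
⁅i⁆∪⁅j⁆≢⊤ (s≤s (s≤s (s≤s _))) zero (suc zero) = λ ()
⁅i⁆∪⁅j⁆≢⊤ (s≤s (s≤s (s≤s _))) zero (suc (suc j)) = λ ()
⁅i⁆∪⁅j⁆≢⊤ (s≤s (s≤s (s≤s _))) (suc zero) zero = λ ()
⁅i⁆∪⁅j⁆≢⊤ (s≤s (s≤s (s≤s _))) (suc zero) (suc zero) = λ ()
⁅i⁆∪⁅j⁆≢⊤ (s≤s (s≤s (s≤s _))) (suc zero) (suc (suc j)) = λ ()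
⁅i⁆∪⁅j⁆≢⊤ (s≤s (s≤s (s≤s _))) (suc (suc i)) zero = λ ()
⁅i⁆∪⁅j⁆≢⊤ (s≤s (s≤s (s≤s _))) (suc (suc i)) (suc zero) = λ ()
⁅i⁆∪⁅j⁆≢⊤ (s≤s (s≤s (s≤s _))) (suc (suc i)) (suc (suc j)) = λ ()

Separated : ∀ {n} → Subset n → Subset n → Set
Separated p q = ∃ λ i → i ∉ₛ p × i ∈ₛ q

separated-∷ : ∀ {n s} {p q : Subset n} → Separated p q → Separated (s ∷ p) (s ∷ q)
separated-∷ (i , i∉p , i∈q) = suc i , i∉p ∘ drop-there , there i∈q

≢⇒separated : ∀ {n} (p q : Subset n) → p ≢ q → Separated p q ⊎ Separated q p
≢⇒separated [] [] p≢q = contradiction refl p≢q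
≢⇒separated (outside ∷ p) (inside ∷ q) _ = inj₁ (zero , (λ ()) , here)
≢⇒separated (inside ∷ p) (outside ∷ q) _ = inj₂ (zero , (λ ()) , here)
≢⇒separated (outside ∷ p) (outside ∷ q) p≢q =
  Sum.map separated-∷ separated-∷ (≢⇒separated p q (p≢q ∘ cong (outside ∷_)))
≢⇒separated (inside ∷ p) (inside ∷ q) p≢q =
  Sum.map separated-∷ separated-∷ (≢⇒separated p q (p≢q ∘ cong (inside ∷_)))

zero∈⇒≡inside∷tail : ∀ {n} {p : Subset (suc n)} → zero ∈ₛ p → p ≡ inside ∷ tail p
zero∈⇒≡inside∷tail {p = inside ∷ p} here = refl

orient : ∀ {n} → Subset (suc n) → Subset (suc n)
orient (inside ∷ p) = inside ∷ p
orient (outside ∷ p) = ∁ (outside ∷ p)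

zero∈orient : ∀ {n} (p : Subset (suc n)) → zero ∈ₛ orient p
zero∈orient (inside ∷ p) = here
zero∈orient (outside ∷ p) = here

orient≢⊤ : ∀ {n} (p : Subset (suc n)) → Nonempty p → p ≢ ⊤ → orient p ≢ ⊤
orient≢⊤ (inside ∷ p) _ p≢⊤ = p≢⊤
orient≢⊤ (outside ∷ p) (suc i , i∈p) _ ∁p≡⊤ =
  x∈p⇒x∉∁p (drop-there i∈p) (drop-there (subst (suc i ∈ₛ_) (sym ∁p≡⊤) ∈⊤))

∁-injective : ∀ {n} {p q : Subset n} → ∁ p ≡ ∁ q → p ≡ q
∁-injective {p = []} {[]} _ = refl
∁-injective {p = x ∷ p} {y ∷ q} eq =
  cong₂ _∷_ (not-injective (∷-injectiveˡ eq)) (∁-injective (∷-injectiveʳ eq))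

∈both⇒≢∁ : ∀ {n} {i : Fin n} {p q : Subset n} → i ∈ₛ p → i ∈ₛ q → p ≢ ∁ q
∈both⇒≢∁ i∈p i∈q refl = x∈p⇒x∉∁p i∈q i∈p

orient-injective : ∀ {n} (p q : Subset (suc n)) → Nonempty (p ∩ q) → orient p ≡ orient q → p ≡ q
orient-injective (inside ∷ p) (inside ∷ q) _ eq = eq
orient-injective (outside ∷ p) (outside ∷ q) _ eq = ∁-injective eq
orient-injective (inside ∷ p) (outside ∷ q) (suc i , i∈p∩q) eq =
  let i∈p , i∈q = x∈p∩q⁻ p q (drop-there i∈p∩q) in
  contradiction (∷-injectiveʳ eq) (∈both⇒≢∁ i∈p i∈q)
orient-injective (outside ∷ p) (inside ∷ q) (suc i , i∈p∩q) eq =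
  let i∈p , i∈q = x∈p∩q⁻ p q (drop-there i∈p∩q) in
  contradiction (sym (∷-injectiveʳ eq)) (∈both⇒≢∁ i∈q i∈p)

subsets : ∀ k → List (Subset k)
subsets zero = [] ∷ []
subsets (suc k) = map (inside ∷_) (subsets k) ++ map (outside ∷_) (subsets k)

nonFullSubsets : ∀ k → List (Subset k)
nonFullSubsets zero = []
nonFullSubsets (suc k) = map (inside ∷_) (nonFullSubsets k) ++ map (outside ∷_) (subsets k)

length-map-∷-++ : ∀ {k} (xs ys : List (Subset k)) →
  length (map (inside ∷_) xs ++ map (outside ∷_) ys) ≡ length xs + length ys
length-map-∷-++ xs ys = trans (length-++ (map (inside ∷_) xs)) (cong₂ _+_ (length-map _ xs) (length-map _ ys))

length-subsets : ∀ k → length (subsets k) ≡ 2 ^ k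
length-subsets zero = refl
length-subsets (suc k) = begin
  length (subsets (suc k))                ≡⟨ length-map-∷-++ (subsets k) (subsets k) ⟩
  length (subsets k) + length (subsets k) ≡⟨ cong₂ _+_ (length-subsets k) (length-subsets k) ⟩
  2 ^ k + 2 ^ k                           ≡⟨ cong (2 ^ k +_) (+-identityʳ (2 ^ k)) ⟨
  2 ^ suc k                               ∎
  where open ≡-Reasoning

length-nonFullSubsets : ∀ k → length (nonFullSubsets k) + 1 ≡ 2 ^ k
length-nonFullSubsets zero = refl
length-nonFullSubsets (suc k) = begin
  length (nonFullSubsets (suc k)) + 1                ≡⟨ cong (_+ 1) (length-map-∷-++ (nonFullSubsets k) (subsets k)) ⟩
  length (nonFullSubsets k) + length (subsets k) + 1 ≡⟨ xy∙z≈xz∙y (length (nonFullSubsets k)) _ 1 ⟩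
  length (nonFullSubsets k) + 1 + length (subsets k) ≡⟨ cong₂ _+_ (length-nonFullSubsets k) (length-subsets k) ⟩
  2 ^ k + 2 ^ k                                      ≡⟨ cong (2 ^ k +_) (+-identityʳ (2 ^ k)) ⟨
  2 ^ suc k                                          ∎
  where open ≡-Reasoning

∈-subsets : ∀ {k} (p : Subset k) → p ∈ subsets k
∈-subsets [] = here refl
∈-subsets (inside ∷ p) = ∈-++⁺ˡ (∈-map⁺ (inside ∷_) (∈-subsets p))
∈-subsets {suc k} (outside ∷ p) = ∈-++⁺ʳ (map (inside ∷_) (subsets k)) (∈-map⁺ (outside ∷_) (∈-subsets p))

≢⊤⇒∈-nonFullSubsets : ∀ {k} (p : Subset k) → p ≢ ⊤ → p ∈ nonFullSubsets k
≢⊤⇒∈-nonFullSubsets [] p≢⊤ = contradiction refl p≢⊤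
≢⊤⇒∈-nonFullSubsets (inside ∷ p) p≢⊤ =
  ∈-++⁺ˡ (∈-map⁺ (inside ∷_) (≢⊤⇒∈-nonFullSubsets p (p≢⊤ ∘ cong (inside ∷_))))
≢⊤⇒∈-nonFullSubsets {suc k} (outside ∷ p) _ =
  ∈-++⁺ʳ (map (inside ∷_) (nonFullSubsets k)) (∈-map⁺ (outside ∷_) (∈-subsets p))

∈-nonFullSubsets⇒≢⊤ : ∀ {k} {p : Subset k} → p ∈ nonFullSubsets k → p ≢ ⊤
∈-nonFullSubsets⇒≢⊤ {suc k} p∈ with ∈-++⁻ (map (inside ∷_) (nonFullSubsets k)) p∈
... | inj₁ p∈ˡ with ∈-map⁻ (inside ∷_) p∈ˡ
...   | q , q∈ , refl = ∈-nonFullSubsets⇒≢⊤ q∈ ∘ ∷-injectiveʳ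
∈-nonFullSubsets⇒≢⊤ {suc k} p∈ | inj₂ p∈ʳ with ∈-map⁻ (outside ∷_) p∈ʳ
...   | q , _ , refl = λ ()

map-∷-disjoint : ∀ {k} (xs ys : List (Subset k)) → Disjoint (map (inside ∷_) xs) (map (outside ∷_) ys)
map-∷-disjoint xs ys (p∈xs , p∈ys) with ∈-map⁻ (inside ∷_) p∈xs | ∈-map⁻ (outside ∷_) p∈ys
... | _ , _ , refl | _ , _ , ()

subsets-unique : ∀ k → Unique (subsets k)
subsets-unique zero = [] ∷ []
subsets-unique (suc k) =
  Unique.++⁺ (Unique.map⁺ ∷-injectiveʳ (subsets-unique k)) (Unique.map⁺ ∷-injectiveʳ (subsets-unique k))
    (map-∷-disjoint (subsets k) (subsets k))

nonFullSubsets-unique : ∀ k → Unique (nonFullSubsets k)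
nonFullSubsets-unique zero = []
nonFullSubsets-unique (suc k) =
  Unique.++⁺ (Unique.map⁺ ∷-injectiveʳ (nonFullSubsets-unique k)) (Unique.map⁺ ∷-injectiveʳ (subsets-unique k))
    (map-∷-disjoint (nonFullSubsets k) (subsets k))

-- Graphs of diameter at most 2

module GraphProperties {A : Set} (V : A → Set) (E : A → A → Set) where
  open Graph V E public

  Diameter≤2 : Set
  Diameter≤2 = ∀ {u w} → V u → V w → Σ (Walk u w) λ p → IsShortest p × len p ≤ 2

  1≤len : ∀ {u w} → u ≢ w → (p : Walk u w) → 1 ≤ len p
  1≤len u≢w (nil _) = contradiction refl u≢w
  1≤len u≢w (cons _ _ _) = s≤s z≤n

  2≤len : ∀ {u w} → u ≢ w → ¬ E u w → (p : Walk u w) → 2 ≤ len p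
  2≤len u≢w _ (nil _) = contradiction refl u≢w
  2≤len u≢w ¬uw (cons _ uw (nil _)) = contradiction uw ¬uw
  2≤len u≢w ¬uw (cons _ _ (cons _ _ _)) = s≤s (s≤s z≤n)

  target∈vertices : ∀ {u w} (p : Walk u w) → w ∈ vertices p
  target∈vertices (nil _) = here refl
  target∈vertices (cons _ _ p) = there (target∈vertices p)

  splitAt : ∀ {u v w} (p : Walk u w) → v ∈ vertices p →
    Σ (Walk u v) λ p₁ → Σ (Walk v w) λ p₂ → len p ≡ len p₁ + len p₂
  splitAt (nil u) (here refl) = nil u , nil u , refl
  splitAt (cons u e p) (here refl) = nil u , cons u e p , refl
  splitAt (cons u e p) (there v∈p) with splitAt p v∈p
  ... | p₁ , p₂ , eq = cons u e p₁ , p₂ , cong suc eq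

  module _ (diam : Diameter≤2) where

    target-strongly-resolves : ∀ {u v} → V u → V v → StronglyResolves v u v
    target-strongly-resolves Vu Vv =
      let p , p-shortest , _ = diam Vu Vv in inj₁ (p , p-shortest , target∈vertices p)

    shortest-len≤2 : ∀ {u w} → V u → V w → (p : Walk u w) → IsShortest p → len p ≤ 2
    shortest-len≤2 Vu Vw p p-shortest = let q , _ , q≤2 = diam Vu Vw in ≤-trans (p-shortest q) q≤2

    geodesic-through : ∀ {x y w} → V x → V w → x ≢ y → y ≢ w →
      (p : Walk x w) → IsShortest p → y ∈ vertices p → E x y × E y w × ¬ E x w
    geodesic-through {x} {y} {w} Vx Vw x≢y y≢w p p-shortest y∈p
      with splitAt p y∈p | ≤⇒≯ (shortest-len≤2 Vx Vw p p-shortest)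
    ... | nil _ , _ , _ | _ = contradiction refl x≢y
    ... | _ , nil _ , _ | _ = contradiction refl y≢w
    ... | cons _ xy (nil _) , cons _ yw (nil _) , len≡2 | _ =
      xy , yw , λ xw → contradiction (subst (_≤ 1) len≡2 (p-shortest (cons x xw (nil w)))) λ { (s≤s ()) }
    ... | cons _ _ (cons _ _ _) , cons _ _ _ , eq | len≯2 =
      contradiction (subst (3 ≤_) (sym eq) (+-mono-≤ {2} {_} {1} (s≤s (s≤s z≤n)) (s≤s z≤n))) len≯2
    ... | cons _ _ _ , cons _ _ (cons _ _ _) , eq | len≯2 =
      contradiction (subst (3 ≤_) (sym eq) (+-mono-≤ {1} {_} {2} (s≤s z≤n) (s≤s (s≤s z≤n)))) len≯2

-- Rings with a support map

Proper : ∀ {n} → Subset n → Set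
Proper p = Nonempty p × p ≢ ⊤

-- For R ≅ F₁ × ⋯ × Fₙ, support x is the set of coordinates where x is nonzero and
-- indicator p is the idempotent e_p with support p.
record SupportMap (R : CRing) (n : ℕ) : Set where
  open CRing R
  field
    support : Carrier → Subset n
    support-* : ∀ x y → support (x * y) ≡ support x ∩ support y
    support≡⊥⇒≡0 : ∀ {x} → support x ≡ ⊥ → x ≡ 0#
    indicator : Subset n → Carrier
    support-indicator : ∀ p → support (indicator p) ≡ p
    _≟_ : DecidableEquality Carrier

module SupportProperties {R : CRing} {n} (S : SupportMap R n) where
  open CRing R using (Carrier; 0#; _*_; isCommutativeRing)
  open IsCommutativeRing isCommutativeRing using (zeroˡ)
  open SupportMap S
  open GraphProperties (IsZ* R) (AdjΓᶜ R)

  support-0 : support 0# ≡ ⊥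
  support-0 = begin
    support 0#                          ≡⟨ cong support (sym (zeroˡ (indicator ⊥))) ⟩
    support (0# * indicator ⊥)          ≡⟨ support-* 0# (indicator ⊥) ⟩
    support 0# ∩ support (indicator ⊥)  ≡⟨ cong (support 0# ∩_) (support-indicator ⊥) ⟩
    support 0# ∩ ⊥                      ≡⟨ ∩-zeroʳ (support 0#) ⟩
    ⊥                                   ∎
    where open ≡-Reasoning

  ≢0⇒nonempty : ∀ {x} → x ≢ 0# → Nonempty (support x)
  ≢0⇒nonempty {x} x≢0 with nonempty? (support x)
  ... | yes nonempty = nonempty
  ... | no empty = contradiction (support≡⊥⇒≡0 (Empty-unique empty)) x≢0

  nonempty⇒≢0 : ∀ {x} → Nonempty (support x) → x ≢ 0#
  nonempty⇒≢0 (i , i∈x) refl = ∉⊥ (subst (i ∈ₛ_) support-0 i∈x)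

  *≢0⇒meet : ∀ {x y} → x * y ≢ 0# → Nonempty (support x ∩ support y)
  *≢0⇒meet {x} {y} = subst Nonempty (support-* x y) ∘ ≢0⇒nonempty

  meet⇒*≢0 : ∀ {x y} → Nonempty (support x ∩ support y) → x * y ≢ 0#
  meet⇒*≢0 {x} {y} = nonempty⇒≢0 ∘ subst Nonempty (sym (support-* x y))

  IsZ*⇒proper : ∀ {x} → IsZ* R x → Proper (support x)
  IsZ*⇒proper {x} (x≢0 , y , y≢0 , xy≡0) = ≢0⇒nonempty x≢0 , λ x≡⊤ →
    let y≡x∩y = trans (sym (∩-identityˡ (support y))) (cong (_∩ support y) (sym x≡⊤))
    in meet⇒*≢0 (subst Nonempty y≡x∩y (≢0⇒nonempty y≢0)) xy≡0

  proper⇒IsZ* : ∀ {x} → Proper (support x) → IsZ* R x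
  proper⇒IsZ* {x} (nonempty , x≢⊤) = nonempty⇒≢0 nonempty , y , y≢0 , xy≡0
    where
    y = indicator (∁ (support x))
    y≢0 : y ≢ 0#
    y≢0 = nonempty⇒≢0 (subst Nonempty (sym (support-indicator _)) (≢⊤⇒∁-nonempty _ x≢⊤))
    xy≡0 : x * y ≡ 0#
    xy≡0 = support≡⊥⇒≡0 (begin
      support (x * y)            ≡⟨ support-* x y ⟩
      support x ∩ support y      ≡⟨ cong (support x ∩_) (support-indicator _) ⟩
      support x ∩ ∁ (support x)  ≡⟨ ∩-inverseʳ (support x) ⟩
      ⊥                          ∎)
      where open ≡-Reasoning

  indicator-injective : ∀ {p q} → indicator p ≡ indicator q → p ≡ q
  indicator-injective {p} {q} eq = trans (sym (support-indicator p)) (trans (cong support eq) (support-indicator q))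

  indicator-IsZ* : ∀ {p} → Proper p → IsZ* R (indicator p)
  indicator-IsZ* {p} = proper⇒IsZ* ∘ subst Proper (sym (support-indicator p))

  adjacent : ∀ {x y} → IsZ* R x → IsZ* R y → x ≢ y → Nonempty (support x ∩ support y) → AdjΓᶜ R x y
  adjacent Zx Zy x≢y meet = Zx , Zy , x≢y , meet⇒*≢0 meet

  adjacent⇒meet : ∀ {x y} → AdjΓᶜ R x y → Nonempty (support x ∩ support y)
  adjacent⇒meet (_ , _ , _ , xy≢0) = *≢0⇒meet xy≢0

  same-support-adjacent : ∀ {x y w} → support x ≡ support y → IsZ* R x → x ≢ w → AdjΓᶜ R y w → AdjΓᶜ R x w
  same-support-adjacent {w = w} x≡y Zx x≢w yw@(_ , Zw , _) =
    adjacent Zx Zw x≢w (subst (λ p → Nonempty (p ∩ support w)) (sym x≡y) (adjacent⇒meet yw))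

  common-neighbour : ∀ {a b} → 3 ≤ n → IsZ* R a → IsZ* R b → ¬ Nonempty (support a ∩ support b) →
    ∃ λ c → AdjΓᶜ R a c × AdjΓᶜ R c b
  common-neighbour {a} {b} 3≤n Za Zb a∩b≡∅
    with i , i∈a ← proj₁ (IsZ*⇒proper Za) | j , j∈b ← proj₁ (IsZ*⇒proper Zb) =
    c , adjacent Za Zc a≢c (i , x∈p∩q⁺ (i∈a , i∈c)) , adjacent Zc Zb c≢b (j , x∈p∩q⁺ (j∈c , j∈b))
    where
    c = indicator (⁅ i ⁆ ∪ ⁅ j ⁆)
    c≡i∪j : support c ≡ ⁅ i ⁆ ∪ ⁅ j ⁆
    c≡i∪j = support-indicator _
    i∈c : i ∈ₛ support c
    i∈c = subst (i ∈ₛ_) (sym c≡i∪j) (x∈p∪q⁺ (inj₁ (x∈⁅x⁆ i)))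
    j∈c : j ∈ₛ support c
    j∈c = subst (j ∈ₛ_) (sym c≡i∪j) (x∈p∪q⁺ (inj₂ (x∈⁅x⁆ j)))
    Zc : IsZ* R c
    Zc = proper⇒IsZ* ((i , i∈c) , subst (_≢ ⊤) (sym c≡i∪j) (⁅i⁆∪⁅j⁆≢⊤ 3≤n i j))
    a≢c : a ≢ c
    a≢c refl = a∩b≡∅ (j , x∈p∩q⁺ (j∈c , j∈b))
    c≢b : c ≢ b
    c≢b refl = a∩b≡∅ (i , x∈p∩q⁺ (i∈a , i∈c))

  Γᶜ-diameter≤2 : 3 ≤ n → Diameter≤2
  Γᶜ-diameter≤2 3≤n {a} {b} Za Zb with a ≟ b
  ... | yes refl = nil a , (λ _ → z≤n) , z≤n
  ... | no a≢b with nonempty? (support a ∩ support b)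
  ...   | yes meet = cons a (adjacent Za Zb a≢b meet) (nil b) , 1≤len a≢b , s≤s z≤n
  ...   | no a∩b≡∅ with c , ac , cb ← common-neighbour 3≤n Za Zb a∩b≡∅ =
    cons a ac (cons c cb (nil b)) , 2≤len a≢b (a∩b≡∅ ∘ adjacent⇒meet) , ≤-refl

module StrongMetricDimension {R : CRing} {k} (S : SupportMap R (suc k)) (3≤n : 3 ≤ suc k) where
  open CRing R using (Carrier)
  open SupportMap S
  open SupportProperties S
  open GraphProperties (IsZ* R) (AdjΓᶜ R)

  diameter≤2 : Diameter≤2
  diameter≤2 = Γᶜ-diameter≤2 3≤n

  orient≡⇒adjacent-trans : ∀ {x y w} → orient (support x) ≡ orient (support y) → IsZ* R x → x ≢ w →
    AdjΓᶜ R x y → AdjΓᶜ R y w → AdjΓᶜ R x w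
  orient≡⇒adjacent-trans {x} {y} eq Zx x≢w xy yw with nonempty? (support x ∩ support y)
  ... | yes meet = same-support-adjacent (orient-injective _ _ meet eq) Zx x≢w yw
  ... | no x∩y≡∅ = contradiction (adjacent⇒meet xy) x∩y≡∅

  outside-resolver⇒orient≢ : ∀ {x y w} → IsZ* R x → IsZ* R y → IsZ* R w → x ≢ y → w ≢ x → w ≢ y →
    StronglyResolves w x y → orient (support x) ≢ orient (support y)
  outside-resolver⇒orient≢ Zx Zy Zw x≢y w≢x w≢y (inj₁ (p , p-shortest , y∈p)) eq =
    let xy , yw , ¬xw = geodesic-through diameter≤2 Zx Zw x≢y (w≢y ∘ sym) p p-shortest y∈p
    in ¬xw (orient≡⇒adjacent-trans eq Zx (w≢x ∘ sym) xy yw)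
  outside-resolver⇒orient≢ Zx Zy Zw x≢y w≢x w≢y (inj₂ (p , p-shortest , x∈p)) eq =
    let yx , xw , ¬yw = geodesic-through diameter≤2 Zy Zw (x≢y ∘ sym) (w≢x ∘ sym) p p-shortest x∈p
    in ¬yw (orient≡⇒adjacent-trans (sym eq) Zy (w≢y ∘ sym) yx xw)

  -- One idempotent for each class {S, ∁S} of proper supports, i.e. for each value of orient.
  IsRepresentative : Carrier → Set
  IsRepresentative x = x ≡ indicator (support x) × zero ∈ₛ support x

  isRepresentative? : Decidable IsRepresentative
  isRepresentative? x = (x ≟ indicator (support x)) ×-dec (zero ∈ₛ? support x)

  representative-injective : ∀ {x y} → IsRepresentative x → IsRepresentative y →
    tail (support x) ≡ tail (support y) → x ≡ y
  representative-injective {x} {y} (x≡ , 0∈x) (y≡ , 0∈y) tail≡ = begin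
    x                                    ≡⟨ x≡ ⟩
    indicator (support x)                ≡⟨ cong indicator (zero∈⇒≡inside∷tail 0∈x) ⟩
    indicator (inside ∷ tail (support x)) ≡⟨ cong (λ p → indicator (inside ∷ p)) tail≡ ⟩
    indicator (inside ∷ tail (support y)) ≡⟨ cong indicator (sym (zero∈⇒≡inside∷tail 0∈y)) ⟩
    indicator (support y)                ≡⟨ sym y≡ ⟩
    y                                    ∎
    where open ≡-Reasoning

  indicator-isRepresentative : ∀ {p} → zero ∈ₛ p → IsRepresentative (indicator p)
  indicator-isRepresentative {p} 0∈p =
    cong indicator (sym (support-indicator p)) , subst (zero ∈ₛ_) (sym (support-indicator p)) 0∈p

  module _ (Z : List Carrier) (Z-enum : Enumerates-Z* R Z) where

    representatives basis : List Carrier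
    representatives = filter isRepresentative? Z
    basis = filter (∁? isRepresentative?) Z

    Z-unique : Unique Z
    Z-unique = proj₁ Z-enum

    ∈Z⇒IsZ* : ∀ {x} → x ∈ Z → IsZ* R x
    ∈Z⇒IsZ* {x} = proj₁ (proj₂ Z-enum x)

    IsZ*⇒∈Z : ∀ {x} → IsZ* R x → x ∈ Z
    IsZ*⇒∈Z {x} = proj₂ (proj₂ Z-enum x)

    ∈representatives⁻ : ∀ {x} → x ∈ representatives → x ∈ Z × IsRepresentative x
    ∈representatives⁻ = ∈-filter⁻ isRepresentative? {xs = Z}

    ∈representatives⁺ : ∀ {x} → IsZ* R x → IsRepresentative x → x ∈ representatives
    ∈representatives⁺ = ∈-filter⁺ isRepresentative? ∘ IsZ*⇒∈Z

    ∈basis⁻ : ∀ {x} → x ∈ basis → x ∈ Z × ¬ IsRepresentative x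
    ∈basis⁻ = ∈-filter⁻ (∁? isRepresentative?) {xs = Z}

    ∈basis⁺ : ∀ {x} → IsZ* R x → ¬ IsRepresentative x → x ∈ basis
    ∈basis⁺ = ∈-filter⁺ (∁? isRepresentative?) ∘ IsZ*⇒∈Z

    length-representatives : length representatives ≡ length (nonFullSubsets k)
    length-representatives = ≤-antisym
      (injectiveOn⇒length≤ (tail ∘ support) (Unique.filter⁺ isRepresentative? Z-unique) tail-into tail-inj)
      (injectiveOn⇒length≤ (indicator ∘ (inside ∷_)) (nonFullSubsets-unique k) indicator-into indicator-inj)
      where
      tail-into : ∀ {x} → x ∈ representatives → tail (support x) ∈ nonFullSubsets k
      tail-into x∈ with x∈Z , _ , 0∈x ← ∈representatives⁻ x∈ =
        ≢⊤⇒∈-nonFullSubsets _ λ tail≡⊤ →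
          proj₂ (IsZ*⇒proper (∈Z⇒IsZ* x∈Z)) (trans (zero∈⇒≡inside∷tail 0∈x) (cong (inside ∷_) tail≡⊤))
      tail-inj : ∀ {x y} → x ∈ representatives → y ∈ representatives →
        tail (support x) ≡ tail (support y) → x ≡ y
      tail-inj x∈ y∈ = representative-injective (proj₂ (∈representatives⁻ x∈)) (proj₂ (∈representatives⁻ y∈))
      indicator-into : ∀ {p} → p ∈ nonFullSubsets k → indicator (inside ∷ p) ∈ representatives
      indicator-into p∈ =
        ∈representatives⁺ (indicator-IsZ* ((zero , here) , ∈-nonFullSubsets⇒≢⊤ p∈ ∘ ∷-injectiveʳ)) (indicator-isRepresentative here)
      indicator-inj : ∀ {p q} → p ∈ nonFullSubsets k → q ∈ nonFullSubsets k →
        indicator (inside ∷ p) ≡ indicator (inside ∷ q) → p ≡ q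
      indicator-inj _ _ = ∷-injectiveʳ ∘ indicator-injective

    separating-vertex : ∀ {u v i} → IsZ* R u → IsZ* R v → IsRepresentative u → IsRepresentative v → u ≢ v →
      i ∉ₛ support u → i ∈ₛ support v →
      ∃ λ w → w ∈ basis × Σ (Walk u w) λ p → IsShortest p × v ∈ vertices p
    separating-vertex {u} {v} {i} Zu Zv (_ , 0∈u) (_ , 0∈v) u≢v i∉u i∈v =
      w , ∈basis⁺ Zw (0∉w ∘ proj₂) ,
      cons u uv (cons v vw (nil w)) , 2≤len u≢w ¬uw , there (here refl)
      where
      w = indicator ⁅ i ⁆
      w≡⁅i⁆ : support w ≡ ⁅ i ⁆
      w≡⁅i⁆ = support-indicator ⁅ i ⁆
      0∉w : zero ∉ₛ support w
      0∉w 0∈w = i∉u (subst (_∈ₛ support u) (x∈⁅y⁆⇒x≡y i (subst (zero ∈ₛ_) w≡⁅i⁆ 0∈w)) 0∈u)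
      Zw : IsZ* R w
      Zw = indicator-IsZ* ((i , x∈⁅x⁆ i) , λ ⁅i⁆≡⊤ → 0∉w (subst (zero ∈ₛ_) (sym (trans w≡⁅i⁆ ⁅i⁆≡⊤)) ∈⊤))
      u≢w : u ≢ w
      u≢w refl = 0∉w 0∈u
      uv : AdjΓᶜ R u v
      uv = adjacent Zu Zv u≢v (zero , x∈p∩q⁺ (0∈u , 0∈v))
      vw : AdjΓᶜ R v w
      vw = adjacent Zv Zw (λ { refl → 0∉w 0∈v }) (i , x∈p∩q⁺ (i∈v , subst (i ∈ₛ_) (sym w≡⁅i⁆) (x∈⁅x⁆ i)))
      ¬uw : ¬ AdjΓᶜ R u w
      ¬uw uw with j , j∈u∩w ← adjacent⇒meet uw =
        let j∈u , j∈w = x∈p∩q⁻ (support u) (support w) j∈u∩w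
        in i∉u (subst (_∈ₛ support u) (x∈⁅y⁆⇒x≡y i (subst (j ∈ₛ_) w≡⁅i⁆ j∈w)) j∈u)

    basis-resolving : IsStrongResolvingSet basis
    basis-resolving = ∈Z⇒IsZ* ∘ proj₁ ∘ ∈basis⁻ , resolve
      where
      resolve : ∀ u v → IsZ* R u → IsZ* R v → u ≢ v → ∃ λ w → w ∈ basis × StronglyResolves w u v
      resolve u v Zu Zv u≢v with isRepresentative? u | isRepresentative? v
      ... | no ¬Ru | _ = u , ∈basis⁺ Zu ¬Ru , Sum.swap (target-strongly-resolves diameter≤2 Zv Zu)
      ... | yes _ | no ¬Rv = v , ∈basis⁺ Zv ¬Rv , target-strongly-resolves diameter≤2 Zu Zv
      ... | yes Ru | yes Rv
        with ≢⇒separated (support u) (support v) (u≢v ∘ representative-injective Ru Rv ∘ cong tail)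
      ...   | inj₁ (i , i∉u , i∈v) =
        let w , w∈ , p = separating-vertex Zu Zv Ru Rv u≢v i∉u i∈v in w , w∈ , inj₁ p
      ...   | inj₂ (i , i∉v , i∈u) =
        let w , w∈ , p = separating-vertex Zv Zu Rv Ru (u≢v ∘ sym) i∉v i∈u in w , w∈ , inj₂ p

    module _ (B : List Carrier) (B-resolving : IsStrongResolvingSet B) where
      open import Data.List.Membership.DecPropositional _≟_ using (_∈?_)

      Z∖B : List Carrier
      Z∖B = filter (∁? (_∈? B)) Z

      length-Z∖B≤length-representatives : length Z∖B ≤ length representatives
      length-Z∖B≤length-representatives =
        injectiveOn⇒length≤ (indicator ∘ orient ∘ support) (Unique.filter⁺ _ Z-unique) into inj
        where
        into : ∀ {x} → x ∈ Z∖B → indicator (orient (support x)) ∈ representatives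
        into {x} x∈ with x∈Z , _ ← ∈-filter⁻ (∁? (_∈? B)) {xs = Z} x∈ =
          let nonempty , x≢⊤ = IsZ*⇒proper (∈Z⇒IsZ* x∈Z) in
          ∈representatives⁺ (indicator-IsZ* ((zero , zero∈orient (support x)) , orient≢⊤ (support x) nonempty x≢⊤))
            (indicator-isRepresentative (zero∈orient (support x)))
        inj : ∀ {x y} → x ∈ Z∖B → y ∈ Z∖B →
          indicator (orient (support x)) ≡ indicator (orient (support y)) → x ≡ y
        inj {x} {y} x∈ y∈ eq with x ≟ y
        ... | yes x≡y = x≡y
        ... | no x≢y
          with x∈Z , x∉B ← ∈-filter⁻ (∁? (_∈? B)) {xs = Z} x∈
             | y∈Z , y∉B ← ∈-filter⁻ (∁? (_∈? B)) {xs = Z} y∈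
          with w , w∈B , w-resolves ← proj₂ B-resolving x y (∈Z⇒IsZ* x∈Z) (∈Z⇒IsZ* y∈Z) x≢y =
          contradiction (indicator-injective eq)
            (outside-resolver⇒orient≢ (∈Z⇒IsZ* x∈Z) (∈Z⇒IsZ* y∈Z) (proj₁ B-resolving w∈B) x≢y
              (λ { refl → x∉B w∈B }) (λ { refl → y∉B w∈B }) w-resolves)

      length-basis≤ : length basis ≤ length B
      length-basis≤ = +-cancelˡ-≤ (length representatives) (length basis) (length B) (begin
        length representatives + length basis  ≡⟨ length-filter-∁ isRepresentative? Z ⟨
        length Z                               ≡⟨ length-filter-∁ (_∈? B) Z ⟩
        length (filter (_∈? B) Z) + length Z∖B ≤⟨ +-mono-≤ Z∩B≤B length-Z∖B≤length-representatives ⟩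
        length B + length representatives      ≡⟨ +-comm (length B) (length representatives) ⟩
        length representatives + length B      ∎)
        where
        open ≤-Reasoning
        Z∩B≤B : length (filter (_∈? B) Z) ≤ length B
        Z∩B≤B = injectiveOn⇒length≤ id (Unique.filter⁺ _ Z-unique) (proj₂ ∘ ∈-filter⁻ (_∈? B) {xs = Z}) (λ _ _ → id)

    sdim-Γᶜ : Σ ℕ λ d → Γᶜ.IsStrongMetricDim R d × d + 2 ^ k ≡ length Z + 1
    sdim-Γᶜ = length basis ,
      ((basis , basis-resolving , Unique.filter⁺ _ Z-unique , refl) , λ B B-resolving _ → length-basis≤ B B-resolving) ,
      (begin
      length basis + 2 ^ k                           ≡⟨ cong (length basis +_) (length-nonFullSubsets k) ⟨
      length basis + (length (nonFullSubsets k) + 1) ≡⟨ cong (λ m → length basis + (m + 1)) length-representatives ⟨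
      length basis + (length representatives + 1)   ≡⟨ x∙yz≈yx∙z (length basis) (length representatives) 1 ⟩
      length representatives + length basis + 1     ≡⟨ cong (_+ 1) (length-filter-∁ isRepresentative? Z) ⟨
      length Z + 1                                   ∎)
      where open ≡-Reasoning

-- Finite products of finite fields

module FieldSupport (F : FiniteField) where
  open FiniteField F
  open IsCommutativeRing isCommutativeRing using (zeroˡ; zeroʳ; *-assoc; *-comm; *-identityˡ)

  _≟_ : DecidableEquality Carrier
  _≟_ = inj⇒≟ (↔⇒↣ (↔-sym enum))

  *-noZeroDivisors : ∀ {a b} → a ≢ 0# → b ≢ 0# → a * b ≢ 0#
  *-noZeroDivisors {a} {b} a≢0 b≢0 ab≡0 with a⁻¹ , aa⁻¹≡1 ← inverse a a≢0 = b≢0 (begin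
    b              ≡⟨ *-identityˡ b ⟨
    1# * b         ≡⟨ cong (_* b) aa⁻¹≡1 ⟨
    (a * a⁻¹) * b  ≡⟨ cong (_* b) (*-comm a a⁻¹) ⟩
    (a⁻¹ * a) * b  ≡⟨ *-assoc a⁻¹ a b ⟩
    a⁻¹ * (a * b)  ≡⟨ cong (a⁻¹ *_) ab≡0 ⟩
    a⁻¹ * 0#       ≡⟨ zeroʳ a⁻¹ ⟩
    0#             ∎)
    where open ≡-Reasoning

  nonzero : Carrier → Side
  nonzero a = not (does (a ≟ 0#))

  nonzero-≡0 : ∀ {a} → a ≡ 0# → nonzero a ≡ outside
  nonzero-≡0 {a} a≡0 = cong not (dec-true (a ≟ 0#) a≡0)

  nonzero-≢0 : ∀ {a} → a ≢ 0# → nonzero a ≡ inside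
  nonzero-≢0 {a} a≢0 = cong not (dec-false (a ≟ 0#) a≢0)

  nonzero≡outside⇒≡0 : ∀ {a} → nonzero a ≡ outside → a ≡ 0#
  nonzero≡outside⇒≡0 {a} eq with a ≟ 0#
  ... | yes a≡0 = a≡0
  ... | no a≢0 = contradiction (trans (sym (nonzero-≢0 a≢0)) eq) λ ()

  nonzero-* : ∀ a b → nonzero (a * b) ≡ nonzero a ∧ nonzero b
  nonzero-* a b with a ≟ 0# | b ≟ 0#
  ... | yes a≡0 | _ =
    trans (nonzero-≡0 (trans (cong (_* b) a≡0) (zeroˡ b))) (sym (cong (_∧ nonzero b) (nonzero-≡0 a≡0)))
  ... | no a≢0 | yes b≡0 =
    trans (nonzero-≡0 (trans (cong (a *_) b≡0) (zeroʳ a))) (sym (cong₂ _∧_ (nonzero-≢0 a≢0) (nonzero-≡0 b≡0)))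
  ... | no a≢0 | no b≢0 =
    trans (nonzero-≢0 (*-noZeroDivisors a≢0 b≢0)) (sym (cong₂ _∧_ (nonzero-≢0 a≢0) (nonzero-≢0 b≢0)))

0ᴾ : ∀ {n} (Fs : Vec FiniteField n) → Prod Fs
0ᴾ [] = tt
0ᴾ (F ∷ Fs) = FiniteField.0# F , 0ᴾ Fs

supportᴾ : ∀ {n} (Fs : Vec FiniteField n) → Prod Fs → Subset n
supportᴾ [] tt = []
supportᴾ (F ∷ Fs) (a , as) = FieldSupport.nonzero F a ∷ supportᴾ Fs as

indicatorᴾ : ∀ {n} (Fs : Vec FiniteField n) → Subset n → Prod Fs
indicatorᴾ [] [] = tt
indicatorᴾ (F ∷ Fs) (s ∷ p) = (if s then FiniteField.1# F else FiniteField.0# F) , indicatorᴾ Fs p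

_≟ᴾ_ : ∀ {n} {Fs : Vec FiniteField n} → DecidableEquality (Prod Fs)
_≟ᴾ_ {Fs = []} = ⊤-≟
_≟ᴾ_ {Fs = F ∷ Fs} = ≡-dec (FieldSupport._≟_ F) _≟ᴾ_

supportᴾ-* : ∀ {n} (Fs : Vec FiniteField n) a b →
  supportᴾ Fs (_*ᴾ_ {Fs = Fs} a b) ≡ supportᴾ Fs a ∩ supportᴾ Fs b
supportᴾ-* [] tt tt = refl
supportᴾ-* (F ∷ Fs) (a , as) (b , bs) = cong₂ _∷_ (FieldSupport.nonzero-* F a b) (supportᴾ-* Fs as bs)

supportᴾ≡⊥⇒≡0ᴾ : ∀ {n} (Fs : Vec FiniteField n) a → supportᴾ Fs a ≡ ⊥ → a ≡ 0ᴾ Fs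
supportᴾ≡⊥⇒≡0ᴾ [] tt _ = refl
supportᴾ≡⊥⇒≡0ᴾ (F ∷ Fs) (a , as) eq =
  cong₂ _,_ (FieldSupport.nonzero≡outside⇒≡0 F (∷-injectiveˡ eq))
            (supportᴾ≡⊥⇒≡0ᴾ Fs as (∷-injectiveʳ eq))

supportᴾ-indicatorᴾ : ∀ {n} (Fs : Vec FiniteField n) p → supportᴾ Fs (indicatorᴾ Fs p) ≡ p
supportᴾ-indicatorᴾ [] [] = refl
supportᴾ-indicatorᴾ (F ∷ Fs) (inside ∷ p) =
  cong₂ _∷_ (FieldSupport.nonzero-≢0 F (FiniteField.1≢0 F)) (supportᴾ-indicatorᴾ Fs p)
supportᴾ-indicatorᴾ (F ∷ Fs) (outside ∷ p) =
  cong₂ _∷_ (FieldSupport.nonzero-≡0 F refl) (supportᴾ-indicatorᴾ Fs p)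

*ᴾ-zeroʳ : ∀ {n} (Fs : Vec FiniteField n) a → _*ᴾ_ {Fs = Fs} a (0ᴾ Fs) ≡ 0ᴾ Fs
*ᴾ-zeroʳ [] tt = refl
*ᴾ-zeroʳ (F ∷ Fs) (a , as) =
  cong₂ _,_ (IsCommutativeRing.zeroʳ (FiniteField.isCommutativeRing F) a) (*ᴾ-zeroʳ Fs as)

ringIso⇒supportMap : ∀ {R : CRing} {n} {Fs : Vec FiniteField n} → RingIso R Fs → SupportMap R n
ringIso⇒supportMap {R} {Fs = Fs} iso = record
  { support = supportᴾ Fs ∘ to
  ; support-* = λ x y → trans (cong (supportᴾ Fs) (to-* x y)) (supportᴾ-* Fs (to x) (to y))
  ; support≡⊥⇒≡0 = λ {x} eq → injective (trans (supportᴾ≡⊥⇒≡0ᴾ Fs (to x) eq) (sym to-0))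
  ; indicator = from ∘ indicatorᴾ Fs
  ; support-indicator = λ p → trans (cong (supportᴾ Fs) (to-from (indicatorᴾ Fs p))) (supportᴾ-indicatorᴾ Fs p)
  ; _≟_ = λ x y → map′ injective (cong to) (to x ≟ᴾ to y)
  }
  where
  open CRing R using (0#; _*_; isCommutativeRing)
  open IsCommutativeRing isCommutativeRing using (zeroˡ)
  open RingIso iso
  injective : ∀ {x y} → to x ≡ to y → x ≡ y
  injective = proj₁ bijective
  from : Prod Fs → CRing.Carrier R
  from a = proj₁ (proj₂ bijective a)
  to-from : ∀ a → to (from a) ≡ a
  to-from a = proj₂ (proj₂ bijective a) refl
  to-0 : to 0# ≡ 0ᴾ Fs
  to-0 = begin
    to 0#                                      ≡⟨ cong to (zeroˡ (from (0ᴾ Fs))) ⟨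
    to (0# * from (0ᴾ Fs))                     ≡⟨ to-* 0# (from (0ᴾ Fs)) ⟩
    _*ᴾ_ {Fs = Fs} (to 0#) (to (from (0ᴾ Fs))) ≡⟨ cong (_*ᴾ_ {Fs = Fs} (to 0#)) (to-from (0ᴾ Fs)) ⟩
    _*ᴾ_ {Fs = Fs} (to 0#) (0ᴾ Fs)             ≡⟨ *ᴾ-zeroʳ Fs (to 0#) ⟩
    0ᴾ Fs                                      ∎
    where open ≡-Reasoning

theorem4p11 : (n : ℕ) → 3 ≤ n → (Fs : Vec FiniteField n) → (R : CRing) → RingIso R Fs →
    (Z : List (CRing.Carrier R)) → Enumerates-Z* R Z →
    Σ ℕ λ k → Γᶜ.IsStrongMetricDim R k × k + 2 ^ (n ∸ 1) ≡ length Z + 1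
theorem4p11 (suc k) 3≤n Fs R iso = StrongMetricDimension.sdim-Γᶜ (ringIso⇒supportMap iso) 3≤n
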